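{- Fix an integer $d\geq 1$ and let $W=\{0,1/2\}$. The family $\{\mathrm{PHP}^{n+d}_n\}_{n\in\mathbb N}$ is almost full, i.e. the number of points of $\{0,1/2\}^{(n+d)n}$ satisfying all inequalities of $\mathrm{PHP}^{n+d}_n$ is at least $2^{(n+d)n}-o(2^{(n+d)n})$.
   Context: $\mathrm{PHP}^m_n$ ($m>n$) is the set of integer linear inequalities over variables $P_{i,j}$, $i\in[m]$, $j\in[n]$: $\sum_{j=1}^n P_{i,j}\geq 1$ for all $i\in[m]$, and $P_{i,k}+P_{j,k}\leq 1$ for all $k\in[n]$ and $i\neq j\in[m]$. -}

module Defs where

open import Data.Bool using (Bool; true; false; _∧_; _∨_; if_then_else_)
open import Data.Nat as ℕ using (ℕ; zero; suc)
open import Data.Fin using (Fin)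
open import Data.Fin.Properties using (_≟_)
open import Data.List using (List; []; _∷_; map; concatMap; foldr; allFin; all)
open import Data.Vec.Functional using () renaming (_∷_ to _∷ᶠ_)
open import Data.Rational using (ℚ; 0ℚ; 1ℚ; ½; _+_; _≤ᵇ_)
open import Relation.Nullary.Decidable using (⌊_⌋)

allFns : {A : Set} (k : ℕ) → List A → List (Fin k → A)
allFns zero    xs = (λ ()) ∷ []
allFns (suc k) xs = concatMap (λ x → map (λ f → x ∷ᶠ f) (allFns k xs)) xs

-- A point of {0,1/2}^{m×n}: each coordinate P i j is 0 (false) or 1/2 (true).
Point : ℕ → ℕ → Set
Point m n = Fin m → Fin n → Bool

allPoints : (m n : ℕ) → List (Point m n)
allPoints m n = allFns m (allFns n (false ∷ true ∷ []))

val : Bool → ℚ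
val false = 0ℚ
val true  = ½

rowSum : {m n : ℕ} → Point m n → Fin m → ℚ
rowSum {n = n} P i = foldr (λ j s → val (P i j) + s) 0ℚ (allFin n)

satisfiesPHP : (m n : ℕ) → Point m n → Bool
satisfiesPHP m n P =
  all (λ i → 1ℚ ≤ᵇ rowSum P i) (allFin m)
  ∧ all (λ k → all (λ i → all (λ j →
        ⌊ i ≟ j ⌋ ∨ (val (P i k) + val (P j k) ≤ᵇ 1ℚ))
      (allFin m)) (allFin m)) (allFin n)

countTrue : {A : Set} → (A → Bool) → List A → ℕ
countTrue p = foldr (λ x c → if p x then suc c else c) 0

solCount : (m n : ℕ) → ℕ
solCount m n = countTrue (satisfiesPHP m n) (allPoints m n)

-- A point of {0,1/2}^{m×n} satisfies every hole inequality P_{i,k} + P_{j,k} ≤ 1, so it solves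
-- PHP^m_n iff each of its rows has at least two entries 1/2.  The rows are independent, so with
-- B = 2^n rows of which c = B − (n + 1) are good there are c^m solutions, and
-- B^m − c^m ≤ m (B − c) B^(m−1).  For m = n + d the fraction of non-solutions is therefore at
-- most (n + d)(n + 1)/2^n, which eventually drops below any 1/(k + 1).
module Submission where

open import Defs
open import Data.Nat using (ℕ; suc; _+_; _*_; _∸_; _^_; _≤_; _≥_)
open import Data.Product using (∃-syntax)

open import Data.Bool using (Bool; true; false; T; _∧_; _∨_)
open import Data.Bool.Properties using (∧-identityʳ; T-≡; T-∨)
open import Data.Fin as Fin using (Fin)
open import Data.Fin.Properties using (_≟_)
open import Data.List using (List; []; _∷_; map; concatMap; foldr; tabulate; allFin; _++_)
open import Data.Bool.ListAction using (all; and)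
open import Data.List.Properties using (foldr-map; map-tabulate; tabulate-cong; ++-identityʳ)
open import Data.List.Relation.Unary.All using (universal)
open import Data.List.Relation.Unary.All.Properties using (all⁻)
open import Data.Nat using (zero; z≤n; s≤s; NonZero; >-nonZero)
open import Data.Nat.Properties hiding (_≟_)
open import Data.Nat.Tactic.RingSolver using (solve-∀)
open import Data.Product using (_,_)
open import Data.Rational as ℚ using (ℚ; 0ℚ; 1ℚ; ½; _≤ᵇ_)
import Data.Rational.Properties as ℚ
open import Data.Sum using (inj₂)
open import Data.Unit using (tt)
open import Data.Vec.Functional using () renaming (_∷_ to _∷ᶠ_)
open import Function using (_∘_; id; Equivalence)
open import Relation.Binary.PropositionalEquality
open import Relation.Nullary.Decidable using (⌊_⌋)

private
  variable
    A B C : Set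
    m n : ℕ

countTrue-++ : (p : A → Bool) (xs ys : List A) →
  countTrue p (xs ++ ys) ≡ countTrue p xs + countTrue p ys
countTrue-++ p []       ys = refl
countTrue-++ p (x ∷ xs) ys with p x
... | true  = cong suc (countTrue-++ p xs ys)
... | false = countTrue-++ p xs ys

countTrue-map : (p : B → Bool) (f : A → B) (xs : List A) →
  countTrue p (map f xs) ≡ countTrue (p ∘ f) xs
countTrue-map p f []       = refl
countTrue-map p f (x ∷ xs) with p (f x)
... | true  = cong suc (countTrue-map p f xs)
... | false = countTrue-map p f xs

countTrue-cong : {p q : A → Bool} → (∀ x → p x ≡ q x) → (xs : List A) →
  countTrue p xs ≡ countTrue q xs
countTrue-cong p≗q []       = refl
countTrue-cong {p = p} {q} p≗q (x ∷ xs) rewrite p≗q x with q x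
... | true  = cong suc (countTrue-cong p≗q xs)
... | false = countTrue-cong p≗q xs

countTrue-mono : {p q : A → Bool} → (∀ x → T (p x) → T (q x)) → (xs : List A) →
  countTrue p xs ≤ countTrue q xs
countTrue-mono p⇒q [] = z≤n
countTrue-mono {p = p} {q} p⇒q (x ∷ xs) with p x | q x | p⇒q x
... | true  | true  | _  = s≤s (countTrue-mono p⇒q xs)
... | false | true  | _  = m≤n⇒m≤1+n (countTrue-mono p⇒q xs)
... | false | false | _  = countTrue-mono p⇒q xs
... | true  | false | pq with () ← pq tt

countTrue-false : (xs : List A) → countTrue (λ _ → false) xs ≡ 0
countTrue-false []       = refl
countTrue-false (x ∷ xs) = countTrue-false xs

countTrue-concatMap-map : (cons : A → B → C) (r : C → Bool) (p : A → Bool) (q : B → Bool) →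
  (∀ x y → r (cons x y) ≡ p x ∧ q y) → (xs : List A) (ys : List B) →
  countTrue r (concatMap (λ x → map (cons x) ys) xs) ≡ countTrue p xs * countTrue q ys
countTrue-concatMap-map cons r p q r≡p∧q []       ys = refl
countTrue-concatMap-map cons r p q r≡p∧q (x ∷ xs) ys = begin
    countTrue r (map (cons x) ys ++ concatMap (λ x → map (cons x) ys) xs)
  ≡⟨ countTrue-++ r (map (cons x) ys) _ ⟩
    countTrue r (map (cons x) ys) + countTrue r (concatMap (λ x → map (cons x) ys) xs)
  ≡⟨ cong₂ _+_ (trans (countTrue-map r (cons x) ys) (countTrue-cong (r≡p∧q x) ys))
               (countTrue-concatMap-map cons r p q r≡p∧q xs ys) ⟩
    countTrue (λ y → p x ∧ q y) ys + countTrue p xs * countTrue q ys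
  ≡⟨ head-term ⟩
    countTrue p (x ∷ xs) * countTrue q ys ∎
  where
  open ≡-Reasoning
  head-term : countTrue (λ y → p x ∧ q y) ys + countTrue p xs * countTrue q ys
            ≡ countTrue p (x ∷ xs) * countTrue q ys
  head-term with p x
  ... | true  = refl
  ... | false = cong (_+ countTrue p xs * countTrue q ys) (countTrue-false ys)

countTrue-allFns : (p : A → Bool) (xs : List A) (m : ℕ) →
  countTrue (λ f → and (tabulate (p ∘ f))) (allFns m xs) ≡ countTrue p xs ^ m
countTrue-allFns p xs zero    = refl
countTrue-allFns p xs (suc m) =
  trans (countTrue-concatMap-map _∷ᶠ_ _ p _ (λ _ _ → refl) xs (allFns m xs))
        (cong (countTrue p xs *_) (countTrue-allFns p xs m))

Row : ℕ → Set
Row n = Fin n → Bool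

Rows : (n : ℕ) → List (Row n)
Rows n = allFns n (false ∷ true ∷ [])

countTrue-Rows-suc : (p : Row (suc n) → Bool) →
  countTrue p (Rows (suc n)) ≡ countTrue (p ∘ (false ∷ᶠ_)) (Rows n) + countTrue (p ∘ (true ∷ᶠ_)) (Rows n)
countTrue-Rows-suc {n} p = begin
    countTrue p (map (false ∷ᶠ_) (Rows n) ++ map (true ∷ᶠ_) (Rows n) ++ [])
  ≡⟨ countTrue-++ p (map (false ∷ᶠ_) (Rows n)) _ ⟩
    countTrue p (map (false ∷ᶠ_) (Rows n)) + countTrue p (map (true ∷ᶠ_) (Rows n) ++ [])
  ≡⟨ cong₂ _+_ (countTrue-map p _ (Rows n))
               (trans (cong (countTrue p) (++-identityʳ (map (true ∷ᶠ_) (Rows n)))) (countTrue-map p _ (Rows n))) ⟩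
    countTrue (p ∘ (false ∷ᶠ_)) (Rows n) + countTrue (p ∘ (true ∷ᶠ_)) (Rows n) ∎
  where open ≡-Reasoning

countTrue-Rows-all : ∀ n → countTrue (λ _ → true) (Rows n) ≡ 2 ^ n
countTrue-Rows-all zero    = refl
countTrue-Rows-all (suc n) =
  trans (countTrue-Rows-suc {n} (λ _ → true))
        (trans (cong₂ _+_ (countTrue-Rows-all n) (countTrue-Rows-all n))
               (cong (2 ^ n +_) (sym (+-identityʳ (2 ^ n)))))

countTrue-Rows-suc-≥ : (p : Row (suc n) → Bool) (p₀ q : Row n → Bool) {a b : ℕ} →
  (∀ r → p (false ∷ᶠ r) ≡ p₀ r) → (∀ r → T (q r) → T (p (true ∷ᶠ r))) →
  2 ^ n ≤ countTrue p₀ (Rows n) + a → 2 ^ n ≤ countTrue q (Rows n) + b →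
  2 ^ suc n ≤ countTrue p (Rows (suc n)) + (b + a)
countTrue-Rows-suc-≥ {n} p p₀ q {a} {b} p-false q⇒p-true p₀-bound q-bound = begin
    2 ^ n + (2 ^ n + 0)
  ≡⟨ cong (2 ^ n +_) (+-identityʳ (2 ^ n)) ⟩
    2 ^ n + 2 ^ n
  ≤⟨ +-mono-≤ p₀-bound q-bound ⟩
    countTrue p₀ (Rows n) + a + (countTrue q (Rows n) + b)
  ≤⟨ +-mono-≤ (+-monoˡ-≤ a (≤-reflexive (sym (countTrue-cong p-false (Rows n)))))
              (+-monoˡ-≤ b (countTrue-mono q⇒p-true (Rows n))) ⟩
    countTrue (p ∘ (false ∷ᶠ_)) (Rows n) + a + (countTrue (p ∘ (true ∷ᶠ_)) (Rows n) + b)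
  ≡⟨ interchange (countTrue (p ∘ (false ∷ᶠ_)) (Rows n)) a (countTrue (p ∘ (true ∷ᶠ_)) (Rows n)) b ⟩
    countTrue (p ∘ (false ∷ᶠ_)) (Rows n) + countTrue (p ∘ (true ∷ᶠ_)) (Rows n) + (b + a)
  ≡⟨ cong (_+ (b + a)) (countTrue-Rows-suc p) ⟨
    countTrue p (Rows (suc n)) + (b + a) ∎
  where
  open ≤-Reasoning
  interchange : ∀ x a y b → x + a + (y + b) ≡ x + y + (b + a)
  interchange = solve-∀

sumR : Row n → ℚ
sumR r = foldr ℚ._+_ 0ℚ (tabulate (val ∘ r))

rowSum≡sumR : (P : Point m n) (i : Fin m) → rowSum P i ≡ sumR (P i)
rowSum≡sumR {n = n} P i =
  trans (sym (foldr-map ℚ._+_ (val ∘ P i) 0ℚ (allFin n)))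
        (cong (foldr ℚ._+_ 0ℚ) (map-tabulate id (val ∘ P i)))

val-nonneg : ∀ b → 0ℚ ℚ.≤ val b
val-nonneg false = ℚ.≤-refl
val-nonneg true  = ℚ.≤ᵇ⇒≤ tt

sumR-nonneg : (r : Row n) → 0ℚ ℚ.≤ sumR r
sumR-nonneg {zero}  r = ℚ.≤-refl
sumR-nonneg {suc n} r = ℚ.+-mono-≤ (val-nonneg (r Fin.zero)) (sumR-nonneg (r ∘ Fin.suc))

sumR-false∷ : (r : Row n) → sumR (false ∷ᶠ r) ≡ sumR r
sumR-false∷ r = ℚ.+-identityˡ (sumR r)

sum≥½ : Row n → Bool
sum≥½ r = ½ ≤ᵇ sumR r

sum≥1 : Row n → Bool
sum≥1 r = 1ℚ ≤ᵇ sumR r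

sum≥½-true∷ : (r : Row n) → T (sum≥½ (true ∷ᶠ r))
sum≥½-true∷ r = ℚ.≤⇒≤ᵇ (subst (ℚ._≤ ½ ℚ.+ sumR r) (ℚ.+-identityʳ ½) (ℚ.+-monoʳ-≤ ½ (sumR-nonneg r)))

-- ½ ℚ.+ ½ computes to 1ℚ.
sum≥1-true∷ : (r : Row n) → T (sum≥½ r) → T (sum≥1 (true ∷ᶠ r))
sum≥1-true∷ r r≥½ = ℚ.≤⇒≤ᵇ (ℚ.+-monoʳ-≤ ½ {½} {sumR r} (ℚ.≤ᵇ⇒≤ r≥½))

count-sum≥½ : ∀ n → 2 ^ n ≤ countTrue sum≥½ (Rows n) + 1
count-sum≥½ zero    = ≤-refl
count-sum≥½ (suc n) =
  countTrue-Rows-suc-≥ {n} sum≥½ sum≥½ (λ _ → true)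
    (λ r → cong (½ ≤ᵇ_) (sumR-false∷ r)) (λ r _ → sum≥½-true∷ r)
    (count-sum≥½ n) (≤-reflexive (trans (sym (countTrue-Rows-all n)) (sym (+-identityʳ _))))

count-sum≥1 : ∀ n → 2 ^ n ≤ countTrue sum≥1 (Rows n) + suc n
count-sum≥1 zero    = ≤-refl
count-sum≥1 (suc n) =
  countTrue-Rows-suc-≥ {n} sum≥1 sum≥1 sum≥½
    (λ r → cong (1ℚ ≤ᵇ_) (sumR-false∷ r)) sum≥1-true∷
    (count-sum≥1 n) (count-sum≥½ n)

count-sum≥1-≤ : ∀ n → countTrue sum≥1 (Rows n) ≤ 2 ^ n
count-sum≥1-≤ n = ≤-trans (countTrue-mono (λ _ _ → tt) (Rows n)) (≤-reflexive (countTrue-Rows-all n))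

val+val≤1 : ∀ a b → T (val a ℚ.+ val b ≤ᵇ 1ℚ)
val+val≤1 false false = tt
val+val≤1 false true  = tt
val+val≤1 true  false = tt
val+val≤1 true  true  = tt

satisfiesPHP≡rows : (P : Point m n) → satisfiesPHP m n P ≡ and (tabulate (sum≥1 ∘ P))
satisfiesPHP≡rows {m} {n} P =
  trans (cong (rowsCovered ∧_) (Equivalence.to T-≡ holes))
  (trans (∧-identityʳ rowsCovered)
  (trans (cong and (map-tabulate id (λ i → 1ℚ ≤ᵇ rowSum P i)))
         (cong and (tabulate-cong (λ i → cong (1ℚ ≤ᵇ_) (rowSum≡sumR P i))))))
  where
  rowsCovered : Bool
  rowsCovered = all (λ i → 1ℚ ≤ᵇ rowSum P i) (allFin m)
  holes : T (all (λ k → all (λ i → all (λ j →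
            ⌊ i ≟ j ⌋ ∨ (val (P i k) ℚ.+ val (P j k) ≤ᵇ 1ℚ))
          (allFin m)) (allFin m)) (allFin n))
  holes = all⁻ _ (universal (λ k → all⁻ _ (universal (λ i → all⁻ _ (universal (λ j →
            Equivalence.from T-∨ (inj₂ (val+val≤1 (P i k) (P j k))))
          (allFin m))) (allFin m))) (allFin n))

solCount≡ : ∀ m n → solCount m n ≡ countTrue sum≥1 (Rows n) ^ m
solCount≡ m n =
  trans (countTrue-cong satisfiesPHP≡rows (allPoints m n)) (countTrue-allFns sum≥1 (Rows n) m)

pow-gap : {B c b : ℕ} → c ≤ B → B ≤ c + b → ∀ m → B ^ suc m ≤ B * c ^ m + m * b * B ^ m
pow-gap {B} c≤B B≤c+b zero    = m≤m+n (B * 1) 0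
pow-gap {B} {c} {b} c≤B B≤c+b (suc m) = begin
    B * B ^ suc m
  ≤⟨ *-monoʳ-≤ B (pow-gap c≤B B≤c+b m) ⟩
    B * (B * cᵐ + m * b * Bᵐ)
  ≡⟨ expand B cᵐ m b Bᵐ ⟩
    B * cᵐ * B + m * b * (B * Bᵐ)
  ≤⟨ +-monoˡ-≤ (m * b * (B * Bᵐ)) (*-monoʳ-≤ (B * cᵐ) B≤c+b) ⟩
    B * cᵐ * (c + b) + m * b * (B * Bᵐ)
  ≡⟨ split-c+b B cᵐ c b m Bᵐ ⟩
    B * (c * cᵐ) + b * (B * cᵐ) + m * b * (B * Bᵐ)
  ≤⟨ +-monoˡ-≤ (m * b * (B * Bᵐ)) (+-monoʳ-≤ (B * (c * cᵐ)) (*-monoʳ-≤ b (*-monoʳ-≤ B (^-monoˡ-≤ m c≤B)))) ⟩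
    B * (c * cᵐ) + b * (B * Bᵐ) + m * b * (B * Bᵐ)
  ≡⟨ collect B c cᵐ b Bᵐ m ⟩
    B * c ^ suc m + suc m * b * B ^ suc m ∎
  where
  open ≤-Reasoning
  cᵐ Bᵐ : ℕ
  cᵐ = c ^ m
  Bᵐ = B ^ m
  expand : ∀ x y m b z → x * (x * y + m * b * z) ≡ x * y * x + m * b * (x * z)
  expand = solve-∀
  split-c+b : ∀ x y c b m z → x * y * (c + b) + m * b * (x * z) ≡ x * (c * y) + b * (x * y) + m * b * (x * z)
  split-c+b = solve-∀
  collect : ∀ x c y b z m → x * (c * y) + b * (x * z) + m * b * (x * z) ≡ x * (c * y) + suc m * b * (x * z)
  collect = solve-∀

*-pow-gap≤pow : {B c b K : ℕ} .{{_ : NonZero B}} → c ≤ B → B ≤ c + b →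
  ∀ m → K * m * b ≤ B → K * (B ^ m ∸ c ^ m) ≤ B ^ m
*-pow-gap≤pow {B} {c} {b} {K} c≤B B≤c+b m Kmb≤B = *-cancelˡ-≤ B (begin
    B * (K * (B ^ m ∸ c ^ m))
  ≡⟨ *-pull-∸ B K (B ^ m) (c ^ m) ⟩
    K * (B * B ^ m ∸ B * c ^ m)
  ≤⟨ *-monoʳ-≤ K (m≤n+o⇒m∸n≤o (B * B ^ m) (B * c ^ m) (pow-gap c≤B B≤c+b m)) ⟩
    K * (m * b * B ^ m)
  ≡⟨ *-assoc-gap K m b (B ^ m) ⟩
    K * m * b * B ^ m
  ≤⟨ *-monoˡ-≤ (B ^ m) Kmb≤B ⟩
    B * B ^ m ∎)
  where
  open ≤-Reasoning
  *-pull-∸ : ∀ x k y z → x * (k * (y ∸ z)) ≡ k * (x * y ∸ x * z)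
  *-pull-∸ x k y z = trans (*-swap x k (y ∸ z)) (cong (k *_) (*-distribˡ-∸ x y z))
    where
    *-swap : ∀ x k w → x * (k * w) ≡ k * (x * w)
    *-swap = solve-∀
  *-assoc-gap : ∀ k m b x → k * (m * b * x) ≡ k * m * b * x
  *-assoc-gap = solve-∀

cube≤2^ : ∀ n → 11 ≤ n → suc n * suc n * suc n ≤ 2 ^ n
cube≤2^ n 11≤n = subst (λ n → suc n * suc n * suc n ≤ 2 ^ n) (m+[n∸m]≡n 11≤n) (from-11 (n ∸ 11))
  where
  open ≤-Reasoning
  -- The bracket is 2 (12 + t)³ − (13 + t)³.
  doubling : ∀ t → (13 + t) * (13 + t) * (13 + t) + (t * t * t + 33 * t * t + 357 * t + 1259)
                 ≡ 2 * ((12 + t) * (12 + t) * (12 + t))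
  doubling = solve-∀
  from-11 : ∀ t → suc (11 + t) * suc (11 + t) * suc (11 + t) ≤ 2 ^ (11 + t)
  from-11 zero    = ≤ᵇ⇒≤ 1728 2048 tt
  from-11 (suc t) = begin
      (13 + t) * (13 + t) * (13 + t)
    ≤⟨ m≤m+n _ _ ⟩
      (13 + t) * (13 + t) * (13 + t) + (t * t * t + 33 * t * t + 357 * t + 1259)
    ≡⟨ doubling t ⟩
      2 * ((12 + t) * (12 + t) * (12 + t))
    ≤⟨ *-monoʳ-≤ 2 (from-11 t) ⟩
      2 * 2 ^ (11 + t) ∎

poly≤2^ : {K d n : ℕ} .{{_ : NonZero d}} → K * d + 11 ≤ n → K * (n + d) * suc n ≤ 2 ^ n
poly≤2^ {K} {d} {n} Kd+11≤n = begin
    K * (n + d) * suc n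
  ≤⟨ *-monoˡ-≤ (suc n) (*-monoʳ-≤ K n+d≤d*[1+n]) ⟩
    K * (d * suc n) * suc n
  ≡⟨ reassoc K d n ⟩
    K * d * suc n * suc n
  ≤⟨ *-monoˡ-≤ (suc n) (*-monoˡ-≤ (suc n) (m≤n⇒m≤1+n (≤-trans (m≤m+n (K * d) 11) Kd+11≤n))) ⟩
    suc n * suc n * suc n
  ≤⟨ cube≤2^ n (≤-trans (m≤n+m 11 (K * d)) Kd+11≤n) ⟩
    2 ^ n ∎
  where
  open ≤-Reasoning
  reassoc : ∀ K d n → K * (d * suc n) * suc n ≡ K * d * suc n * suc n
  reassoc = solve-∀
  n+d≤d*[1+n] : n + d ≤ d * suc n
  n+d≤d*[1+n] = begin
    n + d      ≡⟨ +-comm n d ⟩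
    d + n      ≤⟨ +-monoʳ-≤ d (m≤n*m n d) ⟩
    d + d * n  ≡⟨ *-suc d n ⟨
    d * suc n  ∎

mainTheorem14 : (d : ℕ) → 1 ≤ d →
    ∀ (k : ℕ) → ∃[ N₀ ] ∀ (n : ℕ) → n ≥ N₀ →
      suc k * (2 ^ ((n + d) * n) ∸ solCount (n + d) n) ≤ 2 ^ ((n + d) * n)
mainTheorem14 d 1≤d k = suc k * d + 11 , bound
  where
  instance
    d≢0 : NonZero d
    d≢0 = >-nonZero 1≤d
  bound : ∀ n → n ≥ suc k * d + 11 →
    suc k * (2 ^ ((n + d) * n) ∸ solCount (n + d) n) ≤ 2 ^ ((n + d) * n)
  bound n n≥N₀ rewrite solCount≡ (n + d) n
                     | *-comm (n + d) n
                     | sym (^-*-assoc 2 n (n + d)) =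
    *-pow-gap≤pow {K = suc k} {{m^n≢0 2 n}} (count-sum≥1-≤ n) (count-sum≥1 n) (n + d) (poly≤2^ {suc k} n≥N₀)
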